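{- For $N\in\mathbb{N}$, we have \begin{equation*} F_{N}(a, b; t)=\frac{(1-t q^{N})(a q)_N}{(b q)_{N}}\sum_{n=0}^{N}\genfrac{[}{]}{0pt}{}{N}{n}\frac{(b/a)_n(a q)_{N-n}(a q)^n}{(a q)_{N}(1-t q^n)}. \end{equation*}
   Context: Here $|q|<1$, $(A)_n=(A;q)_n=(1-A)(1-Aq)\cdots(1-Aq^{n-1})$, $\genfrac{[}{]}{0pt}{}{N}{n}=\frac{(q;q)_N}{(q;q)_n(q;q)_{N-n}}$ is the $q$-binomial coefficient, and the finite analogue of Fine's function is $F_{N}(\alpha,\beta;\tau):=\sum_{n=0}^{N}\genfrac{[}{]}{0pt}{}{N}{n}\frac{(\alpha q)_{n}(\tau)_{N-n}(q)_n \tau^{n}}{(\beta q)_{n}(\tau)_N }$. -}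

module Defs where

open import Level using (Level; _⊔_) renaming (suc to lsuc)
open import Data.Nat using (ℕ; zero; suc; _∸_)
open import Relation.Nullary using (¬_)
open import Algebra.Bundles using (CommutativeRing)

-- A field: a commutative ring with 0 ≠ 1 in which every nonzero element
-- has a multiplicative inverse.  (agda-stdlib 2.3 has no Field bundle.)
-- The value of _⁻¹ at 0 is irrelevant (never used under our hypotheses).
record Field (c ℓ : Level) : Set (lsuc (c ⊔ ℓ)) where
  field
    commutativeRing : CommutativeRing c ℓ
  open CommutativeRing commutativeRing public
  field
    _⁻¹       : Carrier → Carrier
    ⁻¹-inverse : ∀ x → ¬ (x ≈ 0#) → x * (x ⁻¹) ≈ 1#
    0≉1        : ¬ (0# ≈ 1#)

module FieldOps {c ℓ : Level} (K : Field c ℓ) where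
  open Field K using (Carrier; _≈_; 0#; 1#; _+_; _*_; _-_; _⁻¹)

  infixl 7 _÷_
  _÷_ : Carrier → Carrier → Carrier
  x ÷ y = x * (y ⁻¹)

  pow : Carrier → ℕ → Carrier
  pow x zero    = 1#
  pow x (suc n) = pow x n * x

  poch : Carrier → Carrier → ℕ → Carrier
  poch q A zero    = 1#
  poch q A (suc n) = poch q A n * (1# - A * pow q n)

  -- q-binomial coefficient [N n] = (q;q)_N / ((q;q)_n (q;q)_{N-n})  (used for n ≤ N)
  qbinom : Carrier → ℕ → ℕ → Carrier
  qbinom q N n = poch q q N ÷ (poch q q n * poch q q (N ∸ n))

  sumTo : (ℕ → Carrier) → ℕ → Carrier
  sumTo f zero    = f zero
  sumTo f (suc N) = sumTo f N + f (suc N)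

  FineF : Carrier → ℕ → Carrier → Carrier → Carrier → Carrier
  FineF q N α β τ =
    sumTo (λ n → qbinom q N n
                   * (poch q (α * q) n * poch q τ (N ∸ n) * poch q q n * pow τ n)
                   ÷ (poch q (β * q) n * poch q τ N)) N

module Submission where

-- After multiplying both sides by (t)_N (bq)_N (a nonzero factor), the claim
-- becomes a polynomial identity between two sums over the antidiagonal
-- n + k = N, weighted by the Gaussian polynomials [n+k, n]:
--   L_N(A,B,t) = Σ [n+k,n] (q)_n (A)_n (Bq^n)_k t^n (t)_k,
--   R_N(A,B,t) = Σ [n+k,n] (A;B)_n (A)_k (t)_n (tq^{n+1})_k,
-- taken at A = aq, B = bq, where (A;B)_n = Π_{i<n} (A - Bq^i).
-- Splitting [N+1,n] by the two q-Pascal rules shows that L and R satisfy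
-- the same first-order recurrence in N, whose coefficients move the
-- parameters (A,B,t) to (Aq,Bq,t) and (A,Bq,tq); since L_0 = R_0 = 1, the
-- two families agree for every N and all parameters.

open import Defs
open import Level using (Level; _⊔_)
open import Data.Nat using (ℕ; _≤_; _∸_)
open import Relation.Nullary using (¬_)

open import Algebra.Bundles using (CommutativeRing)
open import Data.Nat as ℕ using (zero; suc)
import Data.Nat.Properties as ℕP
open import Data.Integer as ℤ using (ℤ; +_; -[1+_])
import Data.Integer.Properties as ℤP
open import Data.Sign as Sign using (Sign)
open import Data.Maybe using (Maybe; just; nothing)
open import Relation.Binary.PropositionalEquality as PE using (_≡_)
open import Relation.Nullary using (yes; no)
open import Algebra.Solver.Ring.AlmostCommutativeRing
  using (fromCommutativeRing; _-Raw-AlmostCommutative⟶_)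
import Algebra.Properties.Ring as RingProperties
import Algebra.Properties.Semiring.Mult.TCOptimised as Multiples
import Relation.Binary.Reasoning.Setoid as SetoidReasoning

-- The library's ring solver normalises polynomials with coefficients in a
-- ring mapped homomorphically into the target ring.  For an arbitrary
-- commutative ring the canonical coefficient ring is ℤ, via i ↦ i·1.
module IntegerCoefficients {c ℓ : Level} (R : CommutativeRing c ℓ) where
  open CommutativeRing R hiding (zero)
  open RingProperties ring
    using (-‿involutive; -0#≈0#; -‿+-comm; -‿distribˡ-*; -‿distribʳ-*)
  open Multiples semiring using (_×_; 1+×; ×-homo-+; ×1-homo-*)
  open SetoidReasoning setoid

  ι : ℕ → Carrier
  ι n = n × 1#

  ⟦_⟧ℤ : ℤ → Carrier
  ⟦ + n ⟧ℤ      = ι n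
  ⟦ -[1+ n ] ⟧ℤ = - ι (suc n)

  cancel-1 : ∀ x y → (1# + x) - (1# + y) ≈ x - y
  cancel-1 x y = begin
    (1# + x) + - (1# + y)    ≈⟨ +-cong (+-comm 1# x) (sym (-‿+-comm 1# y)) ⟩
    (x + 1#) + (- 1# + - y)  ≈⟨ +-assoc x 1# (- 1# + - y) ⟩
    x + (1# + (- 1# + - y))  ≈⟨ +-cong refl (sym (+-assoc 1# (- 1#) (- y))) ⟩
    x + ((1# - 1#) + - y)    ≈⟨ +-cong refl (+-cong (-‿inverseʳ 1#) refl) ⟩
    x + (0# + - y)           ≈⟨ +-cong refl (+-identityˡ (- y)) ⟩
    x - y                    ∎

  ⊖-homo : ∀ m n → ⟦ m ℤ.⊖ n ⟧ℤ ≈ ι m - ι n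
  ⊖-homo m       zero    = sym (trans (+-cong refl -0#≈0#) (+-identityʳ (ι m)))
  ⊖-homo zero    (suc n) = sym (+-identityˡ _)
  ⊖-homo (suc m) (suc n) = begin
    ⟦ suc m ℤ.⊖ suc n ⟧ℤ     ≈⟨ reflexive (PE.cong ⟦_⟧ℤ (ℤP.[1+m]⊖[1+n]≡m⊖n m n)) ⟩
    ⟦ m ℤ.⊖ n ⟧ℤ             ≈⟨ ⊖-homo m n ⟩
    ι m - ι n                ≈⟨ sym (cancel-1 (ι m) (ι n)) ⟩
    (1# + ι m) - (1# + ι n)  ≈⟨ +-cong (sym (1+× m 1#)) (-‿cong (sym (1+× n 1#))) ⟩
    ι (suc m) - ι (suc n)    ∎

  +-homo : ∀ i j → ⟦ i ℤ.+ j ⟧ℤ ≈ ⟦ i ⟧ℤ + ⟦ j ⟧ℤ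
  +-homo (+ m)    (+ n)    = ×-homo-+ 1# m n
  +-homo (+ m)    -[1+ n ] = ⊖-homo m (suc n)
  +-homo -[1+ m ] (+ n)    = trans (⊖-homo n (suc m)) (+-comm _ _)
  +-homo -[1+ m ] -[1+ n ] = begin
    - ι (suc (suc (m ℕ.+ n)))    ≈⟨ -‿cong (reflexive (PE.cong (λ k → ι (suc k)) (PE.sym (ℕP.+-suc m n)))) ⟩
    - ι (suc m ℕ.+ suc n)        ≈⟨ -‿cong (×-homo-+ 1# (suc m) (suc n)) ⟩
    - (ι (suc m) + ι (suc n))  ≈⟨ sym (-‿+-comm _ _) ⟩
    - ι (suc m) + - ι (suc n)  ∎

  signed : Sign → Carrier → Carrier
  signed Sign.+ x = x
  signed Sign.- x = - x

  signed-cong : ∀ s {x y} → x ≈ y → signed s x ≈ signed s y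
  signed-cong Sign.+ p = p
  signed-cong Sign.- p = -‿cong p

  signed-* : ∀ s t x y → signed (s Sign.* t) (x * y) ≈ signed s x * signed t y
  signed-* Sign.+ Sign.+ x y = refl
  signed-* Sign.+ Sign.- x y = -‿distribʳ-* x y
  signed-* Sign.- Sign.+ x y = -‿distribˡ-* x y
  signed-* Sign.- Sign.- x y = begin
    x * y        ≈⟨ sym (-‿involutive (x * y)) ⟩
    - - (x * y)  ≈⟨ -‿cong (-‿distribˡ-* x y) ⟩
    - (- x * y)  ≈⟨ -‿distribʳ-* (- x) y ⟩
    - x * - y    ∎

  ◃-homo : ∀ s n → ⟦ s ℤ.◃ n ⟧ℤ ≈ signed s (ι n)
  ◃-homo Sign.+ zero    = refl
  ◃-homo Sign.- zero    = sym -0#≈0#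
  ◃-homo Sign.+ (suc n) = refl
  ◃-homo Sign.- (suc n) = refl

  sign-abs : ∀ i → ⟦ i ⟧ℤ ≈ signed (ℤ.sign i) (ι ℤ.∣ i ∣)
  sign-abs (+ zero)  = refl
  sign-abs (+ suc n) = refl
  sign-abs -[1+ n ]  = refl

  *-homo : ∀ i j → ⟦ i ℤ.* j ⟧ℤ ≈ ⟦ i ⟧ℤ * ⟦ j ⟧ℤ
  *-homo i j = begin
    ⟦ (s Sign.* t) ℤ.◃ (∣i∣ ℕ.* ∣j∣) ⟧ℤ    ≈⟨ ◃-homo (s Sign.* t) (∣i∣ ℕ.* ∣j∣) ⟩
    signed (s Sign.* t) (ι (∣i∣ ℕ.* ∣j∣))  ≈⟨ signed-cong (s Sign.* t) (×1-homo-* ∣i∣ ∣j∣) ⟩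
    signed (s Sign.* t) (ι ∣i∣ * ι ∣j∣)    ≈⟨ signed-* s t (ι ∣i∣) (ι ∣j∣) ⟩
    signed s (ι ∣i∣) * signed t (ι ∣j∣)    ≈⟨ *-cong (sym (sign-abs i)) (sym (sign-abs j)) ⟩
    ⟦ i ⟧ℤ * ⟦ j ⟧ℤ                        ∎
    where
    s t : Sign
    ∣i∣ ∣j∣ : ℕ
    s = ℤ.sign i
    t = ℤ.sign j
    ∣i∣ = ℤ.∣ i ∣
    ∣j∣ = ℤ.∣ j ∣

  neg-homo : ∀ i → ⟦ ℤ.- i ⟧ℤ ≈ - ⟦ i ⟧ℤ
  neg-homo (+ zero)  = sym -0#≈0#
  neg-homo (+ suc n) = refl
  neg-homo -[1+ n ]  = sym (-‿involutive _)

  homomorphism : ℤ.+-*-rawRing -Raw-AlmostCommutative⟶ fromCommutativeRing R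
  homomorphism = record
    { ⟦_⟧    = ⟦_⟧ℤ
    ; +-homo = +-homo
    ; *-homo = *-homo
    ; -‿homo = neg-homo
    ; 0-homo = refl
    ; 1-homo = refl
    }

  coefficient-equality : ∀ i j → Maybe (⟦ i ⟧ℤ ≈ ⟦ j ⟧ℤ)
  coefficient-equality i j with i ℤ.≟ j
  ... | yes i≡j = just (reflexive (PE.cong ⟦_⟧ℤ i≡j))
  ... | no _    = nothing

  open import Algebra.Solver.Ring ℤ.+-*-rawRing (fromCommutativeRing R)
    homomorphism coefficient-equality public

module FineTransformation {c ℓ : Level} (K : Field c ℓ) where
  open Field K hiding (zero)
  open FieldOps K
  open IntegerCoefficients commutativeRing
    using (solve; _:=_; _:+_; _:*_; _:-_; con; Polynomial)
  open SetoidReasoning setoid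

  𝟏 : ∀ {m} → Polynomial m
  𝟏 = con (+ 1)

  ≉0-* : ∀ {x y} → ¬ (x ≈ 0#) → ¬ (y ≈ 0#) → ¬ (x * y ≈ 0#)
  ≉0-* {x} {y} x≉0 y≉0 xy≈0 = y≉0 (begin
    y                 ≈⟨ sym (*-identityˡ y) ⟩
    1# * y            ≈⟨ *-cong (sym (trans (*-comm (x ⁻¹) x) (⁻¹-inverse x x≉0))) refl ⟩
    (x ⁻¹ * x) * y    ≈⟨ *-assoc (x ⁻¹) x y ⟩
    x ⁻¹ * (x * y)    ≈⟨ *-cong refl xy≈0 ⟩
    x ⁻¹ * 0#         ≈⟨ zeroʳ (x ⁻¹) ⟩
    0#                ∎)

  ≉0-factorˡ : ∀ {x y z} → x ≈ y * z → ¬ (x ≈ 0#) → ¬ (y ≈ 0#)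
  ≉0-factorˡ {z = z} x≈yz x≉0 y≈0 = x≉0 (trans x≈yz (trans (*-cong y≈0 refl) (zeroˡ z)))

  ≉0-factorʳ : ∀ {x y z} → x ≈ y * z → ¬ (x ≈ 0#) → ¬ (z ≈ 0#)
  ≉0-factorʳ {y = y} x≈yz x≉0 z≈0 = x≉0 (trans x≈yz (trans (*-cong refl z≈0) (zeroʳ y)))

  *-inverse-cancel : ∀ x y z → ¬ (y ≈ 0#) → x * y * (y ⁻¹ * z) ≈ x * z
  *-inverse-cancel x y z y≉0 = begin
    x * y * (y ⁻¹ * z)    ≈⟨ solve 4 (λ x y y′ z → x :* y :* (y′ :* z) := x :* (y :* y′) :* z) refl x y (y ⁻¹) z ⟩
    x * (y * y ⁻¹) * z    ≈⟨ *-cong (*-cong refl (⁻¹-inverse y y≉0)) refl ⟩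
    x * 1# * z            ≈⟨ *-cong (*-identityʳ x) refl ⟩
    x * z                 ∎

  ÷-*-cancel : ∀ x y z → ¬ (y ≈ 0#) → x ÷ y * (y * z) ≈ x * z
  ÷-*-cancel x y z y≉0 = begin
    x * y ⁻¹ * (y * z)    ≈⟨ solve 4 (λ x y y′ z → x :* y′ :* (y :* z) := x :* y :* (y′ :* z)) refl x y (y ⁻¹) z ⟩
    x * y * (y ⁻¹ * z)    ≈⟨ *-inverse-cancel x y z y≉0 ⟩
    x * z                 ∎

  *-÷-cancel : ∀ x y → ¬ (y ≈ 0#) → x * y ÷ y ≈ x
  *-÷-cancel x y y≉0 = begin
    x * y * y ⁻¹          ≈⟨ *-cong refl (sym (*-identityʳ (y ⁻¹))) ⟩
    x * y * (y ⁻¹ * 1#)   ≈⟨ *-inverse-cancel x y 1# y≉0 ⟩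
    x * 1#                ≈⟨ *-identityʳ x ⟩
    x                     ∎

  *-cancelʳ : ∀ {x y k} → ¬ (k ≈ 0#) → x * k ≈ y * k → x ≈ y
  *-cancelʳ {x} {y} {k} k≉0 xk≈yk = begin
    x             ≈⟨ sym (*-÷-cancel x k k≉0) ⟩
    x * k ÷ k     ≈⟨ *-cong xk≈yk refl ⟩
    y * k ÷ k     ≈⟨ *-÷-cancel y k k≉0 ⟩
    y             ∎

  pow-+ : ∀ x m n → pow x (m ℕ.+ n) ≈ pow x m * pow x n
  pow-+ x zero    n = sym (*-identityˡ (pow x n))
  pow-+ x (suc m) n = begin
    pow x (m ℕ.+ n) * x      ≈⟨ *-cong (pow-+ x m n) refl ⟩
    pow x m * pow x n * x    ≈⟨ solve 3 (λ u v y → u :* v :* y := u :* y :* v) refl (pow x m) (pow x n) x ⟩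
    pow x m * x * pow x n    ∎

  pow-* : ∀ x y n → pow (x * y) n ≈ pow x n * pow y n
  pow-* x y zero    = sym (*-identityˡ 1#)
  pow-* x y (suc n) = begin
    pow (x * y) n * (x * y)        ≈⟨ *-cong (pow-* x y n) refl ⟩
    pow x n * pow y n * (x * y)    ≈⟨ solve 4 (λ u v x y → u :* v :* (x :* y) := u :* x :* (v :* y)) refl (pow x n) (pow y n) x y ⟩
    pow x n * x * (pow y n * y)    ∎

  module Base (q : Carrier) where

    P : Carrier → ℕ → Carrier
    P = poch q

    poch-cong : ∀ {x y} n → x ≈ y → P x n ≈ P y n
    poch-cong zero    x≈y = refl
    poch-cong (suc n) x≈y = *-cong (poch-cong n x≈y) (+-cong refl (-‿cong (*-cong x≈y refl)))

    poch-shift : ∀ x n → P x (suc n) ≈ (1# - x) * P (x * q) n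
    poch-shift x zero    = solve 1 (λ x → 𝟏 :* (𝟏 :- x :* 𝟏) := (𝟏 :- x) :* 𝟏) refl x
    poch-shift x (suc n) = begin
      P x (suc n) * (1# - x * (pow q n * q))
        ≈⟨ *-cong (poch-shift x n) refl ⟩
      (1# - x) * P (x * q) n * (1# - x * (pow q n * q))
        ≈⟨ solve 4 (λ x p Q r → (𝟏 :- x) :* p :* (𝟏 :- x :* (Q :* r)) := (𝟏 :- x) :* (p :* (𝟏 :- x :* r :* Q)))
                   refl x (P (x * q) n) (pow q n) q ⟩
      (1# - x) * (P (x * q) n * (1# - x * q * pow q n))
        ∎

    poch-split : ∀ x m k → P x (m ℕ.+ k) ≈ P x m * P (x * pow q m) k
    poch-split x zero    k = begin
      P x k            ≈⟨ poch-cong k (sym (*-identityʳ x)) ⟩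
      P (x * 1#) k     ≈⟨ sym (*-identityˡ _) ⟩
      1# * P (x * 1#) k  ∎
    poch-split x (suc m) k = begin
      P x (suc (m ℕ.+ k))                                  ≈⟨ poch-shift x (m ℕ.+ k) ⟩
      (1# - x) * P (x * q) (m ℕ.+ k)                       ≈⟨ *-cong refl (poch-split (x * q) m k) ⟩
      (1# - x) * (P (x * q) m * P (x * q * pow q m) k)     ≈⟨ *-cong refl (*-cong refl (poch-cong k (xq·qᵐ≈x·qᵐ⁺¹ x m))) ⟩
      (1# - x) * (P (x * q) m * P (x * pow q (suc m)) k)   ≈⟨ sym (*-assoc _ _ _) ⟩
      (1# - x) * P (x * q) m * P (x * pow q (suc m)) k     ≈⟨ *-cong (sym (poch-shift x m)) refl ⟩
      P x (suc m) * P (x * pow q (suc m)) k                ∎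
      where
      xq·qᵐ≈x·qᵐ⁺¹ : ∀ x m → x * q * pow q m ≈ x * pow q (suc m)
      xq·qᵐ≈x·qᵐ⁺¹ x m = solve 3 (λ x r Q → x :* r :* Q := x :* (Q :* r)) refl x q (pow q m)

    hpoch : Carrier → Carrier → ℕ → Carrier
    hpoch A B zero    = 1#
    hpoch A B (suc n) = hpoch A B n * (A - B * pow q n)

    hpoch-scale : ∀ A B n → pow q n * hpoch A B n ≈ hpoch (A * q) (B * q) n
    hpoch-scale A B zero    = *-identityˡ 1#
    hpoch-scale A B (suc n) = begin
      pow q n * q * (hpoch A B n * (A - B * pow q n))
        ≈⟨ solve 5 (λ Q r h a b → Q :* r :* (h :* (a :- b :* Q)) := Q :* h :* (a :* r :- b :* r :* Q))
                   refl (pow q n) q (hpoch A B n) A B ⟩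
      pow q n * hpoch A B n * (A * q - B * q * pow q n)
        ≈⟨ *-cong (hpoch-scale A B n) refl ⟩
      hpoch (A * q) (B * q) n * (A * q - B * q * pow q n)
        ∎

    hpoch-shift : ∀ A B n → hpoch A B (suc n) ≈ (A - B) * hpoch A (B * q) n
    hpoch-shift A B zero    = solve 2 (λ a b → 𝟏 :* (a :- b :* 𝟏) := (a :- b) :* 𝟏) refl A B
    hpoch-shift A B (suc n) = begin
      hpoch A B (suc n) * (A - B * (pow q n * q))
        ≈⟨ *-cong (hpoch-shift A B n) refl ⟩
      (A - B) * hpoch A (B * q) n * (A - B * (pow q n * q))
        ≈⟨ solve 5 (λ a b h Q r → (a :- b) :* h :* (a :- b :* (Q :* r)) := (a :- b) :* (h :* (a :- b :* r :* Q)))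
                   refl A B (hpoch A (B * q) n) (pow q n) q ⟩
      (A - B) * (hpoch A (B * q) n * (A - B * q * pow q n))
        ∎

    poch-hpoch : ∀ a b n → ¬ (a ≈ 0#) → P (b ÷ a) n * pow (a * q) n ≈ hpoch (a * q) (b * q) n
    poch-hpoch a b zero    a≉0 = *-identityˡ 1#
    poch-hpoch a b (suc n) a≉0 = begin
      P (b * a ⁻¹) n * (1# - b * a ⁻¹ * pow q n) * (pow (a * q) n * (a * q))
        ≈⟨ solve 7 (λ p w a b a′ Q r → p :* (𝟏 :- b :* a′ :* Q) :* (w :* (a :* r))
                                         := p :* w :* (a :* r :- b :* r :* Q :* (a :* a′)))
                   refl (P (b * a ⁻¹) n) (pow (a * q) n) a b (a ⁻¹) (pow q n) q ⟩
      P (b * a ⁻¹) n * pow (a * q) n * (a * q - b * q * pow q n * (a * a ⁻¹))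
        ≈⟨ *-cong (poch-hpoch a b n a≉0) (+-cong refl (-‿cong (*-cong refl (⁻¹-inverse a a≉0)))) ⟩
      hpoch (a * q) (b * q) n * (a * q - b * q * pow q n * 1#)
        ≈⟨ *-cong refl (+-cong refl (-‿cong (*-identityʳ _))) ⟩
      hpoch (a * q) (b * q) n * (a * q - b * q * pow q n)
        ∎

    -- Gaussian polynomials: gauss n k = [n+k, n]_q, defined by the q-Pascal rule
    -- [n+k+2, n+1] = q^{n+1} [n+k+1, n+1] + [n+k+1, n].
    gauss : ℕ → ℕ → Carrier
    gauss zero    k       = 1#
    gauss (suc n) zero    = 1#
    gauss (suc n) (suc k) = pow q (suc n) * gauss (suc n) k + gauss n (suc k)

    gauss-zeroʳ : ∀ n → gauss n zero ≈ 1#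
    gauss-zeroʳ zero    = refl
    gauss-zeroʳ (suc n) = refl

    -- Ratio of neighbouring coefficients, in a division-free form:
    -- (q^{n+1} - 1) [n+k+1, n+1] = (q^{k+1} - 1) [n+k+1, n].
    gauss-ratio : ∀ n k → (pow q (suc n) - 1#) * gauss (suc n) k ≈ (pow q (suc k) - 1#) * gauss n (suc k)
    gauss-ratio zero    zero    = refl
    gauss-ratio zero    (suc k) = begin
      (1# * q - 1#) * (1# * q * gauss 1 k + 1#)
        ≈⟨ solve 2 (λ r x → (𝟏 :* r :- 𝟏) :* (𝟏 :* r :* x :+ 𝟏) := r :* ((𝟏 :* r :- 𝟏) :* x) :+ (r :- 𝟏))
                   refl q (gauss 1 k) ⟩
      q * ((1# * q - 1#) * gauss 1 k) + (q - 1#)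
        ≈⟨ +-cong (*-cong refl (gauss-ratio zero k)) refl ⟩
      q * ((pow q (suc k) - 1#) * 1#) + (q - 1#)
        ≈⟨ solve 2 (λ r Q → r :* ((Q :- 𝟏) :* 𝟏) :+ (r :- 𝟏) := (Q :* r :- 𝟏) :* 𝟏) refl q (pow q (suc k)) ⟩
      (pow q (suc k) * q - 1#) * 1#
        ∎
    gauss-ratio (suc n) zero    = begin
      (pow q (suc n) * q - 1#) * 1#
        ≈⟨ solve 2 (λ Q r → (Q :* r :- 𝟏) :* 𝟏 := (𝟏 :* r :- 𝟏) :* Q :+ (Q :- 𝟏) :* 𝟏) refl (pow q (suc n)) q ⟩
      (1# * q - 1#) * pow q (suc n) + (pow q (suc n) - 1#) * 1#
        ≈⟨ +-cong refl (gauss-ratio n zero) ⟩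
      (1# * q - 1#) * pow q (suc n) + (1# * q - 1#) * gauss n 1
        ≈⟨ solve 3 (λ Q r x → (𝟏 :* r :- 𝟏) :* Q :+ (𝟏 :* r :- 𝟏) :* x := (𝟏 :* r :- 𝟏) :* (Q :* 𝟏 :+ x))
                   refl (pow q (suc n)) q (gauss n 1) ⟩
      (1# * q - 1#) * (pow q (suc n) * 1# + gauss n 1)
        ∎
    gauss-ratio (suc n) (suc k) = begin
      (Qn * q - 1#) * (Qn * q * Z + X)
        ≈⟨ solve 4 (λ Qn r Z X → (Qn :* r :- 𝟏) :* (Qn :* r :* Z :+ X) := Qn :* r :* ((Qn :* r :- 𝟏) :* Z) :+ (Qn :* r :- 𝟏) :* X)
                   refl Qn q Z X ⟩
      Qn * q * ((Qn * q - 1#) * Z) + (Qn * q - 1#) * X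
        ≈⟨ +-cong (*-cong refl (gauss-ratio (suc n) k)) refl ⟩
      Qn * q * ((Qk - 1#) * X) + (Qn * q - 1#) * X
        ≈⟨ solve 4 (λ Qn r X Qk → Qn :* r :* ((Qk :- 𝟏) :* X) :+ (Qn :* r :- 𝟏) :* X := (Qk :* r :- 𝟏) :* (Qn :* X) :+ (Qn :- 𝟏) :* X)
                   refl Qn q X Qk ⟩
      (Qk * q - 1#) * (Qn * X) + (Qn - 1#) * X
        ≈⟨ +-cong refl (gauss-ratio n (suc k)) ⟩
      (Qk * q - 1#) * (Qn * X) + (Qk * q - 1#) * Y
        ≈⟨ solve 4 (λ Qn r Y X → (r :- 𝟏) :* (Qn :* X) :+ (r :- 𝟏) :* Y := (r :- 𝟏) :* (Qn :* X :+ Y))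
                   refl Qn (Qk * q) Y X ⟩
      (Qk * q - 1#) * (Qn * X + Y)
        ∎
      where
      Qn Qk Z X Y : Carrier
      Qn = pow q (suc n)
      Qk = pow q (suc k)
      Z = gauss (suc (suc n)) k
      X = gauss (suc n) (suc k)
      Y = gauss n (suc (suc k))

    gauss-pascal : ∀ n k → gauss (suc n) (suc k) ≈ gauss (suc n) k + pow q (suc k) * gauss n (suc k)
    gauss-pascal n k = begin
      Qn * Z + Y                   ≈⟨ solve 3 (λ Qn Z Y → Qn :* Z :+ Y := Z :+ ((Qn :- 𝟏) :* Z :+ Y)) refl Qn Z Y ⟩
      Z + ((Qn - 1#) * Z + Y)      ≈⟨ +-cong refl (+-cong (gauss-ratio n k) refl) ⟩
      Z + ((Qk - 1#) * Y + Y)      ≈⟨ solve 3 (λ Qk Z Y → Z :+ ((Qk :- 𝟏) :* Y :+ Y) := Z :+ Qk :* Y) refl Qk Z Y ⟩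
      Z + Qk * Y                   ∎
      where
      Qn Qk Z Y : Carrier
      Qn = pow q (suc n)
      Qk = pow q (suc k)
      Z = gauss (suc n) k
      Y = gauss n (suc k)

    gauss-poch : ∀ n k → gauss n k * (P q n * P q k) ≈ P q (n ℕ.+ k)
    gauss-poch zero    k       = solve 1 (λ x → 𝟏 :* (𝟏 :* x) := x) refl (P q k)
    gauss-poch (suc n) zero    = begin
      1# * (P q (suc n) * 1#)    ≈⟨ solve 1 (λ x → 𝟏 :* (x :* 𝟏) := x) refl (P q (suc n)) ⟩
      P q (suc n)                ≈⟨ reflexive (PE.cong (P q) (PE.sym (ℕP.+-identityʳ (suc n)))) ⟩
      P q (suc n ℕ.+ zero)       ∎
    gauss-poch (suc n) (suc k) = begin
      (Qn * q * X + Y) * (qn * (1# - q * Qn) * (qk * (1# - q * Qk)))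
        ≈⟨ solve 7 (λ Qn r X Y qn qk Qk → (Qn :* r :* X :+ Y) :* (qn :* (𝟏 :- r :* Qn) :* (qk :* (𝟏 :- r :* Qk)))
                                           := Qn :* r :* (X :* (qn :* (𝟏 :- r :* Qn) :* qk)) :* (𝟏 :- r :* Qk)
                                              :+ Y :* (qn :* (qk :* (𝟏 :- r :* Qk))) :* (𝟏 :- r :* Qn))
                   refl Qn q X Y qn qk Qk ⟩
      Qn * q * (X * (qn * (1# - q * Qn) * qk)) * (1# - q * Qk) + Y * (qn * (qk * (1# - q * Qk))) * (1# - q * Qn)
        ≈⟨ +-cong (*-cong (*-cong refl (gauss-poch (suc n) k)) refl)
                  (*-cong (trans (gauss-poch n (suc k)) (reflexive (PE.cong (P q) (ℕP.+-suc n k)))) refl) ⟩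
      Qn * q * R * (1# - q * Qk) + R * (1# - q * Qn)
        ≈⟨ solve 4 (λ Qn r Qk R → Qn :* r :* R :* (𝟏 :- r :* Qk) :+ R :* (𝟏 :- r :* Qn) := R :* (𝟏 :- r :* (Qn :* Qk :* r)))
                   refl Qn q Qk R ⟩
      R * (1# - q * (Qn * Qk * q))
        ≈⟨ *-cong refl (+-cong refl (-‿cong (*-cong refl (*-cong (sym (pow-+ q n k)) refl)))) ⟩
      P q (suc (suc (n ℕ.+ k)))
        ≈⟨ reflexive (PE.cong (P q) (PE.cong suc (PE.sym (ℕP.+-suc n k)))) ⟩
      P q (suc n ℕ.+ suc k)
        ∎
      where
      Qn Qk X Y qn qk R : Carrier
      Qn = pow q n
      Qk = pow q k
      X = gauss (suc n) k
      Y = gauss n (suc k)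
      qn = P q n
      qk = P q k
      R = P q (suc (n ℕ.+ k))

    qbinom-gauss : ∀ {N} n k → n ℕ.+ k ≡ N → ¬ (P q N ≈ 0#) → qbinom q N n ≈ gauss n k
    qbinom-gauss n k PE.refl qN≉0 = begin
      P q (n ℕ.+ k) ÷ (P q n * P q (n ℕ.+ k ∸ n))  ≈⟨ *-cong (sym (gauss-poch n k)) (reflexive (PE.cong (λ j → (P q n * P q j) ⁻¹) (ℕP.m+n∸m≡n n k))) ⟩
      gauss n k * (P q n * P q k) ÷ (P q n * P q k) ≈⟨ *-÷-cancel (gauss n k) (P q n * P q k) D≉0 ⟩
      gauss n k                                     ∎
      where
      D≉0 : ¬ (P q n * P q k ≈ 0#)
      D≉0 = ≉0-factorʳ (sym (gauss-poch n k)) qN≉0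

    -- Sums over the antidiagonal: adsum f N = Σ_{n+k=N} f n k.
    adsum : (ℕ → ℕ → Carrier) → ℕ → Carrier
    adsum f zero    = f zero zero
    adsum f (suc N) = f zero (suc N) + adsum (λ n k → f (suc n) k) N

    adsum-cong : ∀ {f g} N → (∀ n k → n ℕ.+ k ≡ N → f n k ≈ g n k) → adsum f N ≈ adsum g N
    adsum-cong zero    f≈g = f≈g zero zero PE.refl
    adsum-cong (suc N) f≈g = +-cong (f≈g zero (suc N) PE.refl) (adsum-cong N (λ n k e → f≈g (suc n) k (PE.cong suc e)))

    adsum-+ : ∀ f g N → adsum (λ n k → f n k + g n k) N ≈ adsum f N + adsum g N
    adsum-+ f g zero    = refl
    adsum-+ f g (suc N) = begin
      (f 0 (suc N) + g 0 (suc N)) + adsum (λ n k → f (suc n) k + g (suc n) k) N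
        ≈⟨ +-cong refl (adsum-+ (λ n k → f (suc n) k) (λ n k → g (suc n) k) N) ⟩
      (f 0 (suc N) + g 0 (suc N)) + (adsum (λ n k → f (suc n) k) N + adsum (λ n k → g (suc n) k) N)
        ≈⟨ solve 4 (λ a b x y → (a :+ b) :+ (x :+ y) := (a :+ x) :+ (b :+ y)) refl _ _ _ _ ⟩
      (f 0 (suc N) + adsum (λ n k → f (suc n) k) N) + (g 0 (suc N) + adsum (λ n k → g (suc n) k) N)
        ∎

    adsum-* : ∀ x f N → adsum (λ n k → x * f n k) N ≈ x * adsum f N
    adsum-* x f zero    = refl
    adsum-* x f (suc N) = trans (+-cong refl (adsum-* x (λ n k → f (suc n) k) N)) (sym (distribˡ x _ _))

    adsum-last : ∀ f N → adsum f (suc N) ≈ adsum (λ n k → f n (suc k)) N + f (suc N) zero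
    adsum-last f zero    = refl
    adsum-last f (suc N) = trans (+-cong refl (adsum-last (λ n k → f (suc n) k) N)) (sym (+-assoc _ _ _))

    adsum-split : ∀ f α β N →
      (∀ k → f zero (suc k) ≈ α zero k) →
      (∀ n → f (suc n) zero ≈ β n zero) →
      (∀ n k → f (suc n) (suc k) ≈ α (suc n) k + β n (suc k)) →
      adsum f (suc N) ≈ adsum α N + adsum β N
    adsum-split f α β N left bottom interior = begin
      adsum f (suc N)                          ≈⟨ adsum-cong (suc N) split ⟩
      adsum (λ n k → α⁺ n k + β⁺ n k) (suc N)  ≈⟨ adsum-+ α⁺ β⁺ (suc N) ⟩
      adsum α⁺ (suc N) + adsum β⁺ (suc N)      ≈⟨ +-cong (adsum-last α⁺ N) refl ⟩
      (adsum α N + 0#) + (0# + adsum β N)      ≈⟨ +-cong (+-identityʳ _) (+-identityˡ _) ⟩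
      adsum α N + adsum β N                    ∎
      where
      -- α and β, shifted so that they are indexed like f and vanish on the boundary.
      α⁺ β⁺ : ℕ → ℕ → Carrier
      α⁺ n zero    = 0#
      α⁺ n (suc k) = α n k
      β⁺ zero    k = 0#
      β⁺ (suc n) k = β n k

      split : ∀ n k → n ℕ.+ k ≡ suc N → f n k ≈ α⁺ n k + β⁺ n k
      split zero    zero    ()
      split zero    (suc k) _ = trans (left k) (sym (+-identityʳ _))
      split (suc n) zero    _ = trans (bottom n) (sym (+-identityˡ _))
      split (suc n) (suc k) _ = interior n k

    sumTo-adsum : ∀ f N → sumTo f N ≈ adsum (λ n _ → f n) N
    sumTo-adsum f zero    = refl
    sumTo-adsum f (suc N) = begin
      sumTo f N + f (suc N)                              ≈⟨ +-cong (sumTo-adsum f N) refl ⟩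
      adsum (λ n _ → f n) N + f (suc N)                  ≈⟨ sym (adsum-last (λ n _ → f n) N) ⟩
      adsum (λ n _ → f n) (suc N)                        ∎

    sumTo-*ʳ : ∀ f x N → sumTo f N * x ≈ sumTo (λ n → f n * x) N
    sumTo-*ʳ f x zero    = refl
    sumTo-*ʳ f x (suc N) = trans (distribʳ x _ _) (+-cong (sumTo-*ʳ f x N) refl)

    gaussSum : (ℕ → ℕ → Carrier) → ℕ → Carrier
    gaussSum V = adsum (λ n k → gauss n k * V n k)

    gaussSum-pascal₁ : ∀ V N →
      gaussSum V (suc N) ≈ gaussSum (λ n k → pow q n * V n (suc k)) N + gaussSum (λ n k → V (suc n) k) N
    gaussSum-pascal₁ V N =
      adsum-split (λ n k → gauss n k * V n k) (λ n k → gauss n k * (pow q n * V n (suc k)))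
                  (λ n k → gauss n k * V (suc n) k) N
      (λ k → *-cong refl (sym (*-identityˡ _)))
      (λ n → *-cong (sym (gauss-zeroʳ n)) refl)
      (λ n k → solve 4 (λ Q x y v → (Q :* x :+ y) :* v := x :* (Q :* v) :+ y :* v)
                       refl (pow q (suc n)) (gauss (suc n) k) (gauss n (suc k)) (V (suc n) (suc k)))

    gaussSum-pascal₂ : ∀ V N →
      gaussSum V (suc N) ≈ gaussSum (λ n k → V n (suc k)) N + gaussSum (λ n k → pow q k * V (suc n) k) N
    gaussSum-pascal₂ V N =
      adsum-split (λ n k → gauss n k * V n k) (λ n k → gauss n k * V n (suc k))
                  (λ n k → gauss n k * (pow q k * V (suc n) k)) N
      (λ k → refl)
      (λ n → *-cong (sym (gauss-zeroʳ n)) (sym (*-identityˡ _)))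
      (λ n k → trans (*-cong (gauss-pascal n k) refl)
                     (solve 4 (λ x Q y v → (x :+ Q :* y) :* v := x :* v :+ y :* (Q :* v))
                            refl (gauss (suc n) k) (pow q (suc k)) (gauss n (suc k)) (V (suc n) (suc k))))

    gaussSum-combine : ∀ {V W U U′} x y N →
      (∀ n k → n ℕ.+ k ≡ N → V n k + W n k ≈ x * U n k + y * U′ n k) →
      gaussSum V N + gaussSum W N ≈ x * gaussSum U N + y * gaussSum U′ N
    gaussSum-combine {V} {W} {U} {U′} x y N combine = begin
      gaussSum V N + gaussSum W N
        ≈⟨ sym (adsum-+ _ _ N) ⟩
      adsum (λ n k → gauss n k * V n k + gauss n k * W n k) N
        ≈⟨ adsum-cong N (λ n k e → trans (sym (distribˡ _ _ _)) (trans (*-cong refl (combine n k e))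
             (solve 5 (λ g x u y u′ → g :* (x :* u :+ y :* u′) := x :* (g :* u) :+ y :* (g :* u′))
                    refl (gauss n k) x (U n k) y (U′ n k)))) ⟩
      adsum (λ n k → x * (gauss n k * U n k) + y * (gauss n k * U′ n k)) N
        ≈⟨ adsum-+ _ _ N ⟩
      adsum (λ n k → x * (gauss n k * U n k)) N + adsum (λ n k → y * (gauss n k * U′ n k)) N
        ≈⟨ +-cong (adsum-* x _ N) (adsum-* y _ N) ⟩
      x * gaussSum U N + y * gaussSum U′ N
        ∎

    lhsTerm rhsTerm : Carrier → Carrier → Carrier → ℕ → ℕ → Carrier
    lhsTerm A B t n k = P q n * P A n * P (B * pow q n) k * pow t n * P t k
    rhsTerm A B t n k = hpoch A B n * P A k * P t n * P (t * pow q (suc n)) k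

    lhsSum rhsSum : ℕ → Carrier → Carrier → Carrier → Carrier
    lhsSum N A B t = gaussSum (lhsTerm A B t) N
    rhsSum N A B t = gaussSum (rhsTerm A B t) N

    Recurrence : (ℕ → Carrier → Carrier → Carrier → Carrier) → Set (c ⊔ ℓ)
    Recurrence S = ∀ N A B t →
      S (suc N) A B t ≈ (1# - A) * (1# - t * pow q (suc N)) * S N (A * q) (B * q) t
                        + (A - B) * (1# - t) * S N A (B * q) (t * q)

    recurrence-unique : ∀ {S T} → Recurrence S → Recurrence T →
      (∀ A B t → S zero A B t ≈ T zero A B t) → ∀ N A B t → S N A B t ≈ T N A B t
    recurrence-unique recS recT base zero    A B t = base A B t
    recurrence-unique {S} {T} recS recT base (suc N) A B t = begin
      S (suc N) A B t                                ≈⟨ recS N A B t ⟩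
      X * S N (A * q) (B * q) t + Y * S N A (B * q) (t * q)
        ≈⟨ +-cong (*-cong refl (recurrence-unique {S} {T} recS recT base N (A * q) (B * q) t))
                  (*-cong refl (recurrence-unique {S} {T} recS recT base N A (B * q) (t * q))) ⟩
      X * T N (A * q) (B * q) t + Y * T N A (B * q) (t * q) ≈⟨ sym (recT N A B t) ⟩
      T (suc N) A B t                                ∎
      where
      X Y : Carrier
      X = (1# - A) * (1# - t * pow q (suc N))
      Y = (A - B) * (1# - t)

    -- The summand identity behind the recurrence for lhsSum (second Pascal rule).
    -- After the Pochhammer factors are peeled off it is the polynomial identity
    --   (1-BQ)(1-tR) + tR(1-qQ)(1-AQ) = (1-AQ)(1-tqQR) + (A-B)Q(1-tR),  Q = q^n, R = q^k.
    lhsTerm-rec : ∀ A B t {N} n k → n ℕ.+ k ≡ N →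
      lhsTerm A B t n (suc k) + pow q k * lhsTerm A B t (suc n) k
        ≈ (1# - A) * (1# - t * pow q (suc N)) * lhsTerm (A * q) (B * q) t n k
          + (A - B) * (1# - t) * lhsTerm A (B * q) (t * q) n k
    lhsTerm-rec A B t n k PE.refl = begin
      qn * An * P (B * Qn) (suc k) * tn * P t (suc k) + Qk * lhsTerm A B t (suc n) k
        ≈⟨ +-cong (*-cong (*-cong (*-cong refl peel-B) refl) refl) refl ⟩
      qn * An * ((1# - B * Qn) * Pk) * tn * (tk * (1# - t * Qk))
        + Qk * (qn * (1# - q * Qn) * (An * (1# - A * Qn)) * Pk * (tn * t) * tk)
        ≈⟨ solve 12 (λ qn An Pk tn tk Qn Qk A B t r u →
             qn :* An :* ((𝟏 :- B :* Qn) :* Pk) :* tn :* (tk :* (𝟏 :- t :* Qk))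
               :+ Qk :* (qn :* (𝟏 :- r :* Qn) :* (An :* (𝟏 :- A :* Qn)) :* Pk :* (tn :* t) :* tk)
             := (𝟏 :- t :* (Qn :* Qk :* r)) :* (qn :* Pk :* tn :* tk) :* (An :* (𝟏 :- A :* Qn))
                  :+ (A :- B) :* (qn :* An :* Pk :* tn :* Qn) :* (tk :* (𝟏 :- t :* Qk)))
             refl qn An Pk tn tk Qn Qk A B t q q ⟩
      (1# - t * (Qn * Qk * q)) * (qn * Pk * tn * tk) * P A (suc n)
        + (A - B) * (qn * An * Pk * tn * Qn) * P t (suc k)
        ≈⟨ +-cong (*-cong refl (poch-shift A n)) (*-cong refl (poch-shift t k)) ⟩
      (1# - t * (Qn * Qk * q)) * (qn * Pk * tn * tk) * ((1# - A) * P (A * q) n)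
        + (A - B) * (qn * An * Pk * tn * Qn) * ((1# - t) * P (t * q) k)
        ≈⟨ solve 13 (λ qn An Pk tn tk Qn Qk A B t r Aq tq →
             (𝟏 :- t :* (Qn :* Qk :* r)) :* (qn :* Pk :* tn :* tk) :* ((𝟏 :- A) :* Aq)
               :+ (A :- B) :* (qn :* An :* Pk :* tn :* Qn) :* ((𝟏 :- t) :* tq)
             := (𝟏 :- A) :* (𝟏 :- t :* (Qn :* Qk :* r)) :* (qn :* Aq :* Pk :* tn :* tk)
                  :+ (A :- B) :* (𝟏 :- t) :* (qn :* An :* Pk :* (tn :* Qn) :* tq))
             refl qn An Pk tn tk Qn Qk A B t q (P (A * q) n) (P (t * q) k) ⟩
      (1# - A) * (1# - t * (Qn * Qk * q)) * (qn * P (A * q) n * Pk * tn * tk)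
        + (A - B) * (1# - t) * (qn * An * Pk * (tn * Qn) * P (t * q) k)
        ≈⟨ +-cong (*-cong (*-cong refl (+-cong refl (-‿cong (*-cong refl (sym qⁿ⁺ᵏ⁺¹)))))
                          (*-cong (*-cong (*-cong refl (sym shifted-B)) refl) refl))
                  (*-cong refl (*-cong (*-cong (*-cong refl (sym shifted-B)) (sym (pow-* t q n))) refl)) ⟩
      (1# - A) * (1# - t * pow q (suc (n ℕ.+ k))) * lhsTerm (A * q) (B * q) t n k
        + (A - B) * (1# - t) * lhsTerm A (B * q) (t * q) n k
        ∎
      where
      qn An Qn Qk tn tk Pk : Carrier
      qn = P q n
      An = P A n
      Qn = pow q n
      Qk = pow q k
      tn = pow t n
      tk = P t k
      Pk = P (B * (Qn * q)) k
      peel-B : P (B * Qn) (suc k) ≈ (1# - B * Qn) * Pk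
      peel-B = trans (poch-shift (B * Qn) k) (*-cong refl (poch-cong k (*-assoc B Qn q)))
      shifted-B : P (B * q * Qn) k ≈ Pk
      shifted-B = poch-cong k (solve 3 (λ b r Q → b :* r :* Q := b :* (Q :* r)) refl B q Qn)
      qⁿ⁺ᵏ⁺¹ : pow q (suc (n ℕ.+ k)) ≈ Qn * Qk * q
      qⁿ⁺ᵏ⁺¹ = *-cong (pow-+ q n k) refl

    lhsSum-rec : Recurrence lhsSum
    lhsSum-rec N A B t =
      trans (gaussSum-pascal₂ (lhsTerm A B t) N) (gaussSum-combine _ _ N (lhsTerm-rec A B t))

    rhsTerm-sucᵏ : ∀ A B t {N} n k → n ℕ.+ k ≡ N →
      pow q n * rhsTerm A B t n (suc k) ≈ (1# - A) * (1# - t * pow q (suc N)) * rhsTerm (A * q) (B * q) t n k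
    rhsTerm-sucᵏ A B t n k PE.refl = begin
      pow q n * (hpoch A B n * P A (suc k) * P t n * (tQk * (1# - t * Q₁ * Qk)))
        ≈⟨ *-cong refl (*-cong (*-cong (*-cong refl (poch-shift A k)) refl) refl) ⟩
      pow q n * (hpoch A B n * ((1# - A) * P (A * q) k) * P t n * (tQk * (1# - t * Q₁ * Qk)))
        ≈⟨ solve 9 (λ Qn h a Aq tn tQk t Q₁ Qk → Qn :* (h :* ((𝟏 :- a) :* Aq) :* tn :* (tQk :* (𝟏 :- t :* Q₁ :* Qk)))
                       := (𝟏 :- a) :* (𝟏 :- t :* (Q₁ :* Qk)) :* (Qn :* h :* Aq :* tn :* tQk))
                   refl (pow q n) (hpoch A B n) A (P (A * q) k) (P t n) tQk t Q₁ Qk ⟩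
      (1# - A) * (1# - t * (Q₁ * Qk)) * (pow q n * hpoch A B n * P (A * q) k * P t n * tQk)
        ≈⟨ *-cong (*-cong refl (+-cong refl (-‿cong (*-cong refl (sym (pow-+ q (suc n) k))))))
                  (*-cong (*-cong (*-cong (hpoch-scale A B n) refl) refl) refl) ⟩
      (1# - A) * (1# - t * pow q (suc (n ℕ.+ k))) * rhsTerm (A * q) (B * q) t n k
        ∎
      where
      Q₁ Qk tQk : Carrier
      Q₁ = pow q (suc n)
      Qk = pow q k
      tQk = P (t * Q₁) k

    rhsTerm-sucⁿ : ∀ A B t n k →
      rhsTerm A B t (suc n) k ≈ (A - B) * (1# - t) * rhsTerm A (B * q) (t * q) n k
    rhsTerm-sucⁿ A B t n k = begin
      hpoch A B (suc n) * P A k * P t (suc n) * W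
        ≈⟨ *-cong (*-cong (*-cong (hpoch-shift A B n) refl) (poch-shift t n)) refl ⟩
      (A - B) * hpoch A (B * q) n * P A k * ((1# - t) * P (t * q) n) * W
        ≈⟨ solve 7 (λ a b h Ak t tq W → (a :- b) :* h :* Ak :* ((𝟏 :- t) :* tq) :* W
                                          := (a :- b) :* (𝟏 :- t) :* (h :* Ak :* tq :* W))
                   refl A B (hpoch A (B * q) n) (P A k) t (P (t * q) n) W ⟩
      (A - B) * (1# - t) * (hpoch A (B * q) n * P A k * P (t * q) n * W)
        ≈⟨ *-cong refl (*-cong refl (poch-cong k (solve 3 (λ t Q r → t :* (Q :* r) := t :* r :* Q) refl t (pow q (suc n)) q))) ⟩
      (A - B) * (1# - t) * rhsTerm A (B * q) (t * q) n k
        ∎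
      where
      W : Carrier
      W = P (t * pow q (suc (suc n))) k

    rhsSum-rec : Recurrence rhsSum
    rhsSum-rec N A B t =
      trans (gaussSum-pascal₁ (rhsTerm A B t) N)
            (gaussSum-combine _ _ N (λ n k n+k≡N → +-cong (rhsTerm-sucᵏ A B t n k n+k≡N) (rhsTerm-sucⁿ A B t n k)))

    lhsSum≈rhsSum : ∀ N A B t → lhsSum N A B t ≈ rhsSum N A B t
    lhsSum≈rhsSum = recurrence-unique {lhsSum} {rhsSum} lhsSum-rec rhsSum-rec
      (λ A B t → solve 0 (𝟏 :* (𝟏 :* 𝟏 :* 𝟏 :* 𝟏 :* 𝟏) := 𝟏 :* (𝟏 :* 𝟏 :* 𝟏 :* 𝟏)) refl)

    fine-summand : ∀ a b t {N} n k → n ℕ.+ k ≡ N →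
      ¬ (P q N ≈ 0#) → ¬ (P (b * q) N ≈ 0#) → ¬ (P t N ≈ 0#) →
      qbinom q N n * (P (a * q) n * P t (N ∸ n) * P q n * pow t n) ÷ (P (b * q) n * P t N)
        * (P t N * P (b * q) N)
        ≈ gauss n k * lhsTerm (a * q) (b * q) t n k
    fine-summand a b t {N} n k n+k≡N@PE.refl qN≉0 bqN≉0 tN≉0 = begin
      qbinom q N n * X ÷ Y * (P t N * P (b * q) N)
        ≈⟨ *-cong refl (trans (*-cong refl (poch-split (b * q) n k))
                              (solve 3 (λ t b p → t :* (b :* p) := b :* t :* p) refl (P t N) Bn Pk)) ⟩
      qbinom q N n * X ÷ Y * (Y * Pk)
        ≈⟨ ÷-*-cancel (qbinom q N n * X) Y Pk Y≉0 ⟩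
      qbinom q N n * (P (a * q) n * P t (N ∸ n) * P q n * pow t n) * Pk
        ≈⟨ *-cong (*-cong (qbinom-gauss n k n+k≡N qN≉0)
                          (*-cong (*-cong (*-cong refl (reflexive (PE.cong (P t) (ℕP.m+n∸m≡n n k)))) refl) refl)) refl ⟩
      gauss n k * (P (a * q) n * P t k * P q n * pow t n) * Pk
        ≈⟨ solve 7 (λ g A tk qn tn Pk z → g :* (A :* tk :* qn :* tn) :* Pk := g :* (qn :* A :* Pk :* tn :* tk))
                   refl (gauss n k) (P (a * q) n) (P t k) (P q n) (pow t n) Pk Pk ⟩
      gauss n k * lhsTerm (a * q) (b * q) t n k
        ∎
      where
      X Bn Y Pk : Carrier
      X = P (a * q) n * P t (N ∸ n) * P q n * pow t n
      Bn = P (b * q) n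
      Y = Bn * P t N
      Pk = P (b * q * pow q n) k
      Y≉0 : ¬ (Y ≈ 0#)
      Y≉0 = ≉0-* (≉0-factorˡ (poch-split (b * q) n k) bqN≉0) tN≉0

    prefactor : ∀ a b t {N} n k → n ℕ.+ k ≡ N → ¬ (P (b * q) N ≈ 0#) →
      (1# - t * pow q N) * P (a * q) N ÷ P (b * q) N * (P t N * P (b * q) N)
        ≈ P (a * q) N * (1# - t * pow q n) * (P t n * P (t * pow q (suc n)) k)
    prefactor a b t {N} n k PE.refl bqN≉0 = begin
      T₁ * AN ÷ BN * (P t N * BN)              ≈⟨ *-cong refl (*-comm (P t N) BN) ⟩
      T₁ * AN ÷ BN * (BN * P t N)              ≈⟨ ÷-*-cancel (T₁ * AN) BN (P t N) bqN≉0 ⟩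
      T₁ * AN * P t N                          ≈⟨ solve 3 (λ T A p → T :* A :* p := A :* (p :* T)) refl T₁ AN (P t N) ⟩
      AN * P t (suc N)                         ≈⟨ *-cong refl (poch-split t (suc n) k) ⟩
      AN * (P t n * (1# - t * pow q n) * tQk)  ≈⟨ solve 4 (λ A p u w → A :* (p :* u :* w) := A :* u :* (p :* w))
                                                         refl AN (P t n) (1# - t * pow q n) tQk ⟩
      AN * (1# - t * pow q n) * (P t n * tQk)  ∎
      where
      T₁ AN BN tQk : Carrier
      T₁ = 1# - t * pow q N
      AN = P (a * q) N
      BN = P (b * q) N
      tQk = P (t * pow q (suc n)) k

    rhs-summand : ∀ a b t {N} n k → n ℕ.+ k ≡ N → ¬ (a ≈ 0#) →
      ¬ (P q N ≈ 0#) → ¬ (P (a * q) N ≈ 0#) → ¬ (P (b * q) N ≈ 0#) → ¬ (1# - t * pow q n ≈ 0#) →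
      qbinom q N n * (P (b ÷ a) n * P (a * q) (N ∸ n) * pow (a * q) n) ÷ (P (a * q) N * (1# - t * pow q n))
        * ((1# - t * pow q N) * P (a * q) N ÷ P (b * q) N * (P t N * P (b * q) N))
        ≈ gauss n k * rhsTerm (a * q) (b * q) t n k
    rhs-summand a b t {N} n k n+k≡N@PE.refl a≉0 qN≉0 aqN≉0 bqN≉0 u≉0 = begin
      qbinom q N n * X ÷ Y * (C * (P t N * P (b * q) N))
        ≈⟨ *-cong refl (prefactor a b t n k n+k≡N bqN≉0) ⟩
      qbinom q N n * X ÷ Y * (Y * Z)
        ≈⟨ ÷-*-cancel (qbinom q N n * X) Y Z (≉0-* aqN≉0 u≉0) ⟩
      qbinom q N n * (P (b ÷ a) n * P (a * q) (N ∸ n) * pow (a * q) n) * Z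
        ≈⟨ *-cong (*-cong (qbinom-gauss n k n+k≡N qN≉0)
                          (*-cong (*-cong refl (reflexive (PE.cong (P (a * q)) (ℕP.m+n∸m≡n n k)))) refl)) refl ⟩
      gauss n k * (P (b ÷ a) n * P (a * q) k * pow (a * q) n) * Z
        ≈⟨ *-cong (*-cong refl (solve 3 (λ p A w → p :* A :* w := p :* w :* A) refl (P (b ÷ a) n) (P (a * q) k) (pow (a * q) n))) refl ⟩
      gauss n k * (P (b ÷ a) n * pow (a * q) n * P (a * q) k) * Z
        ≈⟨ *-cong (*-cong refl (*-cong (poch-hpoch a b n a≉0) refl)) refl ⟩
      gauss n k * (hpoch (a * q) (b * q) n * P (a * q) k) * (P t n * P (t * pow q (suc n)) k)
        ≈⟨ solve 5 (λ g h A p w → g :* (h :* A) :* (p :* w) := g :* (h :* A :* p :* w))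
                   refl (gauss n k) (hpoch (a * q) (b * q) n) (P (a * q) k) (P t n) (P (t * pow q (suc n)) k) ⟩
      gauss n k * rhsTerm (a * q) (b * q) t n k
        ∎
      where
      X Y C Z : Carrier
      X = P (b ÷ a) n * P (a * q) (N ∸ n) * pow (a * q) n
      Y = P (a * q) N * (1# - t * pow q n)
      C = (1# - t * pow q N) * P (a * q) N ÷ P (b * q) N
      Z = P t n * P (t * pow q (suc n)) k

lemma9p1 : {c ℓ : Level} (K : Field c ℓ) →
    let open Field K
        open FieldOps K
    in (q a b t : Carrier) (N : ℕ) →
       ¬ (a ≈ 0#) →
       ¬ (poch q q N ≈ 0#) →
       ¬ (poch q (a * q) N ≈ 0#) →
       ¬ (poch q (b * q) N ≈ 0#) →
       ¬ (poch q t N ≈ 0#) →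
       ((n : ℕ) → n ≤ N → ¬ (1# - t * pow q n ≈ 0#)) →
       FineF q N a b t
         ≈ (1# - t * pow q N) * poch q (a * q) N ÷ poch q (b * q) N
           * sumTo (λ n → qbinom q N n
                            * (poch q (b ÷ a) n * poch q (a * q) (N ∸ n) * pow (a * q) n)
                            ÷ (poch q (a * q) N * (1# - t * pow q n))) N
lemma9p1 K q a b t N a≉0 qN≉0 aqN≉0 bqN≉0 tN≉0 u≉0 = *-cancelʳ (≉0-* tN≉0 bqN≉0) (begin
  sumTo lhsSummand N * M                    ≈⟨ sumTo-*ʳ lhsSummand M N ⟩
  sumTo (λ n → lhsSummand n * M) N          ≈⟨ sumTo-adsum _ N ⟩
  adsum (λ n _ → lhsSummand n * M) N        ≈⟨ adsum-cong N (λ n k e → fine-summand a b t n k e qN≉0 bqN≉0 tN≉0) ⟩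
  lhsSum N (a * q) (b * q) t                ≈⟨ lhsSum≈rhsSum N (a * q) (b * q) t ⟩
  rhsSum N (a * q) (b * q) t                ≈⟨ adsum-cong N (λ n k e → sym (rhs-summand a b t n k e a≉0 qN≉0 aqN≉0 bqN≉0
                                                                                (u≉0 n (PE.subst (n ℕ.≤_) e (ℕP.m≤m+n n k))))) ⟩
  adsum (λ n _ → rhsSummand n * (C * M)) N  ≈⟨ sumTo-adsum _ N ⟨
  sumTo (λ n → rhsSummand n * (C * M)) N    ≈⟨ sumTo-*ʳ rhsSummand (C * M) N ⟨
  sumTo rhsSummand N * (C * M)              ≈⟨ solve 3 (λ s C M → s :* (C :* M) := C :* s :* M) refl (sumTo rhsSummand N) C M ⟩
  C * sumTo rhsSummand N * M                ∎)
  where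
  open Field K hiding (zero)
  open FieldOps K
  open FineTransformation K
  open Base q
  open IntegerCoefficients commutativeRing using (solve; _:=_; _:*_)
  open SetoidReasoning setoid

  M C : Carrier
  M = poch q t N * poch q (b * q) N
  C = (1# - t * pow q N) * poch q (a * q) N ÷ poch q (b * q) N

  lhsSummand rhsSummand : ℕ → Carrier
  lhsSummand n = qbinom q N n * (poch q (a * q) n * poch q t (N ∸ n) * poch q q n * pow t n)
                   ÷ (poch q (b * q) n * poch q t N)
  rhsSummand n = qbinom q N n * (poch q (b ÷ a) n * poch q (a * q) (N ∸ n) * pow (a * q) n)
                   ÷ (poch q (a * q) N * (1# - t * pow q n))
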